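{- The randomized node-weighted pivoting algorithm described below outputs a clustering whose expected cost is at most $3$ times the optimum of Node-Weighted Correlation Clustering.
   Context: Node-Weighted Correlation Clustering: given $G=(V,E)$ and positive weights $\{\omega_u\}_{u\in V}$, find a partition $C$ of $V$ minimizing $\sum_{uv\in E\triangle E_C}\omega_u\omega_v$, where $E_C$ is the set of pairs inside common parts. Algorithm: while $V\ne\emptyset$, sample a pivot $u$ from the current vertex set $V$ with probability $\omega_u/\sum_{v\in V}\omega_v$ (independently of previous choices given the current state), add the cluster consisting of $u$ and its neighbors in the current graph, and remove these nodes and their incident edges.
   Formalization: The node weights $\omega_u$ are positive rationals rather than positive reals. -}

module Defs where

open import Data.Bool using (Bool; true; false; _∧_; _∨_; not; _xor_; if_then_else_)
open import Data.Nat using (ℕ; zero; suc)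
import Data.Nat as ℕ
open import Data.Fin using (Fin; toℕ; _≟_)
open import Data.Integer using (+_; -[1+_])
open import Data.List using (List; []; _∷_; map; concatMap; foldr; allFin)
open import Data.Bool.ListAction using (any)
open import Data.Product using (_×_; _,_)
open import Data.Rational using (ℚ; mkℚ; 0ℚ; 1ℚ; _+_; _*_; _÷_)
open import Relation.Nullary using (does)

boolFilter : ∀ {A : Set} → (A → Bool) → List A → List A
boolFilter p [] = []
boolFilter p (x ∷ xs) = if p x then x ∷ boolFilter p xs else boolFilter p xs

sumℚ : List ℚ → ℚ
sumℚ = foldr _+_ 0ℚ

-- Division, returning 0 when the divisor is 0 (never happens in our use:
-- the divisor is a total weight of a nonempty set of positive weights).
divOr0 : ℚ → ℚ → ℚ
divOr0 p (mkℚ (+ zero) _ _) = 0ℚ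
divOr0 p q@(mkℚ (+ suc _) _ _) = p ÷ q
divOr0 p q@(mkℚ -[1+ _ ] _ _) = p ÷ q

eqF : ∀ {n} → Fin n → Fin n → Bool
eqF u v = does (u ≟ v)

Graph : ℕ → Set
Graph n = Fin n → Fin n → Bool

Weights : ℕ → Set
Weights n = Fin n → ℚ

-- A partition of V is described by its "same part" relation.
-- Cost: sum over unordered pairs {u,v} (u < v) in E △ E_C of ω_u ω_v.
cost : ∀ {n} → Graph n → Weights n → (Fin n → Fin n → Bool) → ℚ
cost {n} G ω same =
  sumℚ (concatMap (λ u → map (λ v →
      if (ℕ._<ᵇ_ (toℕ u) (toℕ v)) ∧ (G u v xor same u v)
      then ω u * ω v else 0ℚ) (allFin n)) (allFin n))

-- Every partition of Fin n arises from a labeling Fin n → Fin n.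
sameLabel : ∀ {n} → (Fin n → Fin n) → Fin n → Fin n → Bool
sameLabel L u v = eqF (L u) (L v)

Clusters : ℕ → Set
Clusters n = List (List (Fin n))

memb : ∀ {n} → Fin n → List (Fin n) → Bool
memb u C = any (eqF u) C

sameClusters : ∀ {n} → Clusters n → Fin n → Fin n → Bool
sameClusters cl u v = any (λ C → memb u C ∧ memb v C) cl

totalWeight : ∀ {n} → Weights n → List (Fin n) → ℚ
totalWeight ω S = sumℚ (map ω S)

-- Output distribution of the pivot algorithm, as a list of
-- (probability, clustering) pairs, starting from current vertex set S.
-- The fuel argument bounds the number of rounds (each round removes the pivot).
pivotDist : ∀ {n} → Graph n → Weights n → ℕ → List (Fin n) → List (ℚ × Clusters n)
pivotDist G ω zero S = (1ℚ , []) ∷ []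
pivotDist G ω (suc k) [] = (1ℚ , []) ∷ []
pivotDist G ω (suc k) S@(_ ∷ _) =
  concatMap (λ u →
    let C    = boolFilter (λ v → eqF v u ∨ G u v) S
        rest = boolFilter (λ v → not (memb v C)) S
        pu   = divOr0 (ω u) (totalWeight ω S)
    in map (λ { (p , cl) → (pu * p , C ∷ cl) }) (pivotDist G ω k rest))
    S

expectedPivotCost : ∀ {n} → Graph n → Weights n → ℚ
expectedPivotCost {n} G ω =
  sumℚ (map (λ { (p , cl) → p * cost G ω (sameClusters cl) })
            (pivotDist G ω n (allFin n)))

-- Every disagreement of the pivot clustering is charged to a bad triangle, a triple {a, b, x} spanning
-- exactly two edges: a pair ab ends up wrongly decided only in a round whose pivot x forms a bad triangle
-- with a and b while a, b and x are all still unclustered.  Let T(a,b,x) be ω_a ω_b ω_x times the expected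
-- sum of 1/W over the rounds in which a, b, x are all unclustered, W being the weight of the vertices left;
-- then Σ_x T(a,b,x) is ω_a ω_b times the probability that ab is charged, and T is symmetric in a, b, x.
-- So the algorithm pays at most Σ_{a<b} Σ_x T(a,b,x).  A pair is charged at most once, so Σ_x T(a,b,x) is
-- at most ω_a ω_b, and any clustering pays at least Σ_{a<b} [ab violated] Σ_x T(a,b,x).  Since equality of
-- labels is transitive, every clustering violates a pair of each bad triangle, and by the symmetry of T the
-- three pairs of a triangle collect the same total, which gives the factor 3.

module Submission where

open import Defs
open import Algebra.Bundles using (CommutativeMonoid)
import Algebra.Properties.CommutativeSemigroup as CommutativeSemigroupProperties
open import Data.Bool using (Bool; true; false; T; _∧_; _∨_; not; _xor_; if_then_else_)
open import Data.Bool.Properties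
  using (∧-comm; ∧-identityʳ; ∧-zeroʳ; ∨-identityʳ; ∨-zeroʳ; ∧-conicalˡ; ∧-conicalʳ; ∨-conicalˡ;
         ∨-conicalʳ; xor-same; ∧-commutativeMonoid)
open import Data.Fin as Fin using (Fin; toℕ; _≟_)
open import Data.Fin.Properties using (0≢1+n; suc-injective; toℕ-injective)
import Data.Integer as ℤ
open import Data.List using (List; []; _∷_; _++_; map; concatMap; length; tabulate; allFin)
import Data.List.Properties as List
open import Data.Nat as ℕ using (ℕ; zero; suc; _<ᵇ_; _<?_)
import Data.Nat.Properties as ℕₚ
open import Data.Product using (_×_; _,_; proj₁; proj₂)
open import Data.Rational
  using (ℚ; mkℚ; 0ℚ; 1ℚ; _+_; _*_; _/_; 1/_; _≤_; _<_; _≤?_; *<*; positive; nonNegative)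
open import Data.Rational.Properties hiding (_≟_; _<?_)
open import Data.Rational.Solver using (module +-*-Solver)
open import Function using (_∘_)
open import Relation.Binary.Definitions using (tri<; tri≈; tri>)
open import Relation.Binary.PropositionalEquality
open import Relation.Nullary using (yes; no; contradiction)
open import Relation.Nullary.Decidable using (dec-true; dec-false)

private
  module ℚ+ = CommutativeSemigroupProperties (CommutativeMonoid.commutativeSemigroup +-0-commutativeMonoid)
  module ℚ* = CommutativeSemigroupProperties (CommutativeMonoid.commutativeSemigroup *-1-commutativeMonoid)
  module 𝔹∧ = CommutativeSemigroupProperties (CommutativeMonoid.commutativeSemigroup ∧-commutativeMonoid)

*-monoˡ-≤-0≤ : ∀ {r p q} → 0ℚ ≤ r → p ≤ q → r * p ≤ r * q
*-monoˡ-≤-0≤ {r} 0≤r = *-monoˡ-≤-nonNeg r {{nonNegative 0≤r}}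

*-monoʳ-≤-0≤ : ∀ {r p q} → 0ℚ ≤ r → p ≤ q → p * r ≤ q * r
*-monoʳ-≤-0≤ {r} 0≤r = *-monoʳ-≤-nonNeg r {{nonNegative 0≤r}}

0≤* : ∀ {p q} → 0ℚ ≤ p → 0ℚ ≤ q → 0ℚ ≤ p * q
0≤* {p} {q} 0≤p 0≤q = subst (_≤ p * q) (*-zeroʳ p) (*-monoˡ-≤-0≤ 0≤p 0≤q)

p≤p+q : ∀ p {q} → 0ℚ ≤ q → p ≤ p + q
p≤p+q p 0≤q = subst (_≤ p + _) (+-identityʳ p) (+-monoʳ-≤ p 0≤q)

p≤q+p : ∀ p {q} → 0ℚ ≤ q → p ≤ q + p
p≤q+p p {q} 0≤q = subst (p ≤_) (+-comm p q) (p≤p+q p 0≤q)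

p+p≤q+q⇒p≤q : ∀ {p q} → p + p ≤ q + q → p ≤ q
p+p≤q+q⇒p≤q {p} {q} p+p≤q+q with p ≤? q
... | yes p≤q = p≤q
... | no  p≰q = contradiction (<-≤-trans (+-mono-< (≰⇒> p≰q) (≰⇒> p≰q)) p+p≤q+q) (<-irrefl refl)

∑ : ∀ {A : Set} → List A → (A → ℚ) → ℚ
∑ xs f = sumℚ (map f xs)

syntax ∑ xs (λ x → e) = ∑[ x ∈ xs ] e

module _ {A : Set} where

  ∑-cong : ∀ (xs : List A) {f g : A → ℚ} → (∀ x → f x ≡ g x) → ∑ xs f ≡ ∑ xs g
  ∑-cong []       f≗g = refl
  ∑-cong (x ∷ xs) f≗g = cong₂ _+_ (f≗g x) (∑-cong xs f≗g)

  ∑-zero : ∀ (xs : List A) → ∑[ x ∈ xs ] 0ℚ ≡ 0ℚ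
  ∑-zero []       = refl
  ∑-zero (x ∷ xs) = trans (+-identityˡ _) (∑-zero xs)

  ∑-distrib-+ : ∀ (xs : List A) (f g : A → ℚ) → ∑[ x ∈ xs ] (f x + g x) ≡ ∑ xs f + ∑ xs g
  ∑-distrib-+ []       f g = sym (+-identityʳ 0ℚ)
  ∑-distrib-+ (x ∷ xs) f g =
    trans (cong (f x + g x +_) (∑-distrib-+ xs f g)) (ℚ+.interchange (f x) (g x) (∑ xs f) (∑ xs g))

  ∑-*ˡ : ∀ (xs : List A) (c : ℚ) (f : A → ℚ) → ∑[ x ∈ xs ] (c * f x) ≡ c * ∑ xs f
  ∑-*ˡ []       c f = sym (*-zeroʳ c)
  ∑-*ˡ (x ∷ xs) c f = trans (cong (c * f x +_) (∑-*ˡ xs c f)) (sym (*-distribˡ-+ c (f x) (∑ xs f)))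

  ∑-*ʳ : ∀ (xs : List A) (c : ℚ) (f : A → ℚ) → ∑[ x ∈ xs ] (f x * c) ≡ ∑ xs f * c
  ∑-*ʳ xs c f = trans (∑-cong xs (λ x → *-comm (f x) c)) (trans (∑-*ˡ xs c f) (*-comm c (∑ xs f)))

  ∑-mono-≤ : ∀ (xs : List A) {f g : A → ℚ} → (∀ x → f x ≤ g x) → ∑ xs f ≤ ∑ xs g
  ∑-mono-≤ []       f≤g = ≤-refl
  ∑-mono-≤ (x ∷ xs) f≤g = +-mono-≤ (f≤g x) (∑-mono-≤ xs f≤g)

  0≤∑ : ∀ (xs : List A) {f : A → ℚ} → (∀ x → 0ℚ ≤ f x) → 0ℚ ≤ ∑ xs f
  0≤∑ xs 0≤f = subst (_≤ ∑ xs _) (∑-zero xs) (∑-mono-≤ xs 0≤f)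

  ∑-++ : ∀ (xs ys : List A) (f : A → ℚ) → ∑ (xs ++ ys) f ≡ ∑ xs f + ∑ ys f
  ∑-++ []       ys f = sym (+-identityˡ _)
  ∑-++ (x ∷ xs) ys f = trans (cong (f x +_) (∑-++ xs ys f)) (sym (+-assoc (f x) _ _))

  ∑-map : ∀ {B : Set} (ys : List B) (h : B → A) (f : A → ℚ) → ∑ (map h ys) f ≡ ∑[ y ∈ ys ] f (h y)
  ∑-map []       h f = refl
  ∑-map (y ∷ ys) h f = cong (f (h y) +_) (∑-map ys h f)

  ∑-concatMap : ∀ {B : Set} (ys : List B) (g : B → List A) (f : A → ℚ) →
                ∑ (concatMap g ys) f ≡ ∑[ y ∈ ys ] ∑ (g y) f
  ∑-concatMap []       g f = refl
  ∑-concatMap (y ∷ ys) g f =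
    trans (∑-++ (g y) (concatMap g ys) f) (cong (∑ (g y) f +_) (∑-concatMap ys g f))

∑-comm : ∀ {A B : Set} (xs : List A) (ys : List B) (F : A → B → ℚ) →
         ∑[ x ∈ xs ] ∑[ y ∈ ys ] F x y ≡ ∑[ y ∈ ys ] ∑[ x ∈ xs ] F x y
∑-comm []       ys F = sym (∑-zero ys)
∑-comm (x ∷ xs) ys F =
  trans (cong (∑ ys (F x) +_) (∑-comm xs ys F)) (sym (∑-distrib-+ ys (F x) (λ y → ∑[ x ∈ xs ] F x y)))

∑³ : ∀ {A : Set} → List A → (A → A → A → ℚ) → ℚ
∑³ xs F = ∑[ a ∈ xs ] ∑[ b ∈ xs ] ∑[ c ∈ xs ] F a b c

module _ {A : Set} (xs : List A) where

  ∑³-cong : ∀ {F H : A → A → A → ℚ} → (∀ a b c → F a b c ≡ H a b c) → ∑³ xs F ≡ ∑³ xs H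
  ∑³-cong F≗H = ∑-cong xs (λ a → ∑-cong xs (λ b → ∑-cong xs (F≗H a b)))

  ∑³-mono-≤ : ∀ {F H : A → A → A → ℚ} → (∀ a b c → F a b c ≤ H a b c) → ∑³ xs F ≤ ∑³ xs H
  ∑³-mono-≤ F≤H = ∑-mono-≤ xs (λ a → ∑-mono-≤ xs (λ b → ∑-mono-≤ xs (F≤H a b)))

  ∑³-distrib-+ : ∀ (F H : A → A → A → ℚ) →
                 ∑³ xs (λ a b c → F a b c + H a b c) ≡ ∑³ xs F + ∑³ xs H
  ∑³-distrib-+ F H = trans
    (∑-cong xs (λ a → trans (∑-cong xs (λ b → ∑-distrib-+ xs (F a b) (H a b))) (∑-distrib-+ xs _ _)))
    (∑-distrib-+ xs _ _)

  ∑³-swap₁₂ : ∀ (F : A → A → A → ℚ) → ∑³ xs F ≡ ∑³ xs (λ a b c → F b a c)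
  ∑³-swap₁₂ F = ∑-comm xs xs (λ a b → ∑[ c ∈ xs ] F a b c)

  ∑³-swap₂₃ : ∀ (F : A → A → A → ℚ) → ∑³ xs F ≡ ∑³ xs (λ a b c → F a c b)
  ∑³-swap₂₃ F = ∑-cong xs (λ a → ∑-comm xs xs (F a))

𝔼 : ∀ {A : Set} → List (ℚ × A) → (A → ℚ) → ℚ
𝔼 D f = ∑[ px ∈ D ] (proj₁ px * f (proj₂ px))

𝔼-point : ∀ {A : Set} (x : A) (f : A → ℚ) → 𝔼 ((1ℚ , x) ∷ []) f ≡ f x
𝔼-point x f = trans (+-identityʳ _) (*-identityˡ _)

module _ {A : Set} (D : List (ℚ × A)) where

  𝔼-cong : ∀ {f g : A → ℚ} → (∀ x → f x ≡ g x) → 𝔼 D f ≡ 𝔼 D g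
  𝔼-cong f≗g = ∑-cong D (λ px → cong (proj₁ px *_) (f≗g (proj₂ px)))

  𝔼-*ˡ : ∀ c (f : A → ℚ) → 𝔼 D (λ x → c * f x) ≡ c * 𝔼 D f
  𝔼-*ˡ c f = trans (∑-cong D (λ px → ℚ*.x∙yz≈y∙xz (proj₁ px) c (f (proj₂ px)))) (∑-*ˡ D c _)

  𝔼-∑ : ∀ {B : Set} (ys : List B) (F : B → A → ℚ) →
        𝔼 D (λ x → ∑[ y ∈ ys ] F y x) ≡ ∑[ y ∈ ys ] 𝔼 D (F y)
  𝔼-∑ ys F = trans (∑-cong D (λ px → sym (∑-*ˡ ys (proj₁ px) (λ y → F y (proj₂ px))))) (∑-comm D ys _)

𝟙 : Bool → ℚ
𝟙 true  = 1ℚ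
𝟙 false = 0ℚ

0≤𝟙 : ∀ b → 0ℚ ≤ 𝟙 b
0≤𝟙 true  = ≤ᵇ⇒≤ _
0≤𝟙 false = ≤-refl

𝟙-mono : ∀ p q → (p ≡ true → q ≡ true) → 𝟙 p ≤ 𝟙 q
𝟙-mono true  q p⇒q rewrite p⇒q refl = ≤-refl
𝟙-mono false q _   = 0≤𝟙 q

𝟙≤1 : ∀ b → 𝟙 b ≤ 1ℚ
𝟙≤1 true  = ≤-refl
𝟙≤1 false = ≤ᵇ⇒≤ _

𝟙-∧ : ∀ p q → 𝟙 (p ∧ q) ≡ 𝟙 p * 𝟙 q
𝟙-∧ true  q = sym (*-identityˡ (𝟙 q))
𝟙-∧ false q = sym (*-zeroˡ (𝟙 q))

1≤𝟙+𝟙+𝟙 : ∀ p q r → p ∨ (q ∨ r) ≡ true → 1ℚ ≤ 𝟙 p + 𝟙 q + 𝟙 r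
1≤𝟙+𝟙+𝟙 true  q     r     _ = ≤-trans (p≤p+q 1ℚ (0≤𝟙 q)) (p≤p+q (1ℚ + 𝟙 q) (0≤𝟙 r))
1≤𝟙+𝟙+𝟙 false true  r     _ = p≤p+q 1ℚ (0≤𝟙 r)
1≤𝟙+𝟙+𝟙 false false true  _ = ≤-refl
1≤𝟙+𝟙+𝟙 false false false ()

𝟙+𝟙≤𝟙 : ∀ p q r → (r ≡ false → p ≡ false) → (r ≡ false → q ≡ false) →
         (p ≡ true → q ≡ false) → 𝟙 p + 𝟙 q ≤ 𝟙 r
𝟙+𝟙≤𝟙 true  true  true  _  _  p⇒¬q with p⇒¬q refl
... | ()
𝟙+𝟙≤𝟙 true  false true  _  _  _ = ≤-refl
𝟙+𝟙≤𝟙 false true  true  _  _  _ = ≤-refl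
𝟙+𝟙≤𝟙 false false true  _  _  _ = ≤ᵇ⇒≤ _
𝟙+𝟙≤𝟙 p     q     false ¬r⇒¬p ¬r⇒¬q _ rewrite ¬r⇒¬p refl | ¬r⇒¬q refl = ≤-refl

𝟙-covered : ∀ p s m → (p ≡ true → 1ℚ ≤ s) → 0ℚ ≤ m → 𝟙 p * m ≤ s * (𝟙 p * m)
𝟙-covered true  s m 1≤s 0≤m =
  subst (_≤ s * (1ℚ * m)) (*-identityˡ (1ℚ * m)) (*-monoʳ-≤-0≤ (0≤* (0≤𝟙 true) 0≤m) (1≤s refl))
𝟙-covered false s m _   _   =
  ≤-reflexive (trans (*-zeroˡ m) (sym (trans (cong (s *_) (*-zeroˡ m)) (*-zeroʳ s))))

if-∧-as-𝟙 : ∀ p d x → (if p ∧ d then x else 0ℚ) ≡ 𝟙 p * (x * 𝟙 d)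
if-∧-as-𝟙 true  true  x = sym (trans (*-identityˡ _) (*-identityʳ x))
if-∧-as-𝟙 true  false x = sym (trans (*-identityˡ _) (*-zeroʳ x))
if-∧-as-𝟙 false d     x = sym (*-zeroˡ (x * 𝟙 d))

module _ {n : ℕ} where

  eqF-refl : ∀ (u : Fin n) → eqF u u ≡ true
  eqF-refl u = dec-true (u ≟ u) refl

  eqF-≢ : ∀ {u v : Fin n} → u ≢ v → eqF u v ≡ false
  eqF-≢ {u} {v} = dec-false (u ≟ v)

  eqF⇒≡ : ∀ (u v : Fin n) → eqF u v ≡ true → u ≡ v
  eqF⇒≡ u v eq with u ≟ v
  ... | yes u≡v = u≡v

  eqF-sym : ∀ (u v : Fin n) → eqF u v ≡ eqF v u
  eqF-sym u v with u ≟ v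
  ... | yes refl = sym (eqF-refl u)
  ... | no u≢v   = sym (eqF-≢ (u≢v ∘ sym))

  memb-here : ∀ (x : Fin n) xs → memb x (x ∷ xs) ≡ true
  memb-here x xs rewrite eqF-refl x = refl

  memb-there : ∀ (y x : Fin n) xs → memb y xs ≡ true → memb y (x ∷ xs) ≡ true
  memb-there y x xs y∈xs = trans (cong (eqF y x ∨_) y∈xs) (∨-zeroʳ (eqF y x))

  memb-boolFilter : ∀ (v : Fin n) (p : Fin n → Bool) S → memb v (boolFilter p S) ≡ memb v S ∧ p v
  memb-boolFilter v p []       = refl
  memb-boolFilter v p (x ∷ xs) with p x in px | v ≟ x
  ... | true  | yes refl = trans (memb-here v (boolFilter p xs)) (sym px)
  ... | false | yes refl = begin
    memb v (boolFilter p xs) ≡⟨ memb-boolFilter v p xs ⟩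
    memb v xs ∧ p v          ≡⟨ cong (memb v xs ∧_) px ⟩
    memb v xs ∧ false        ≡⟨ ∧-zeroʳ (memb v xs) ⟩
    false                    ≡⟨ px ⟨
    p v                      ∎
    where open ≡-Reasoning
  ... | true  | no v≢x rewrite eqF-≢ v≢x = memb-boolFilter v p xs
  ... | false | no _ = memb-boolFilter v p xs

  data Nodup : List (Fin n) → Set where
    []  : Nodup []
    _∷_ : ∀ {x xs} → memb x xs ≡ false → Nodup xs → Nodup (x ∷ xs)

  Nodup-boolFilter : ∀ (p : Fin n → Bool) {S} → Nodup S → Nodup (boolFilter p S)
  Nodup-boolFilter p []                  = []
  Nodup-boolFilter p {x ∷ xs} (x∉xs ∷ nd) with p x
  ... | true  = trans (memb-boolFilter x p xs) (cong (_∧ p x) x∉xs) ∷ Nodup-boolFilter p nd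
  ... | false = Nodup-boolFilter p nd

  ∑-δ : ∀ (x : Fin n) (g : Fin n → ℚ) {S} → Nodup S →
        ∑[ u ∈ S ] (𝟙 (eqF x u) * g u) ≡ 𝟙 (memb x S) * g x
  ∑-δ x g []                      = sym (*-zeroˡ (g x))
  ∑-δ x g {y ∷ ys} (y∉ys ∷ nd) with x ≟ y
  ... | no _     = trans (cong₂ _+_ (*-zeroˡ (g y)) (∑-δ x g nd)) (+-identityˡ _)
  ... | yes refl = begin
    1ℚ * g x + ∑[ u ∈ ys ] (𝟙 (eqF x u) * g u) ≡⟨ cong (1ℚ * g x +_) (∑-δ x g nd) ⟩
    1ℚ * g x + 𝟙 (memb x ys) * g x              ≡⟨ cong (λ b → 1ℚ * g x + 𝟙 b * g x) y∉ys ⟩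
    1ℚ * g x + 0ℚ * g x                         ≡⟨ cong (1ℚ * g x +_) (*-zeroˡ (g x)) ⟩
    1ℚ * g x + 0ℚ                               ≡⟨ +-identityʳ _ ⟩
    1ℚ * g x                                    ∎
    where open ≡-Reasoning

  length-boolFilter≤ : ∀ (p : Fin n → Bool) S → length (boolFilter p S) ℕ.≤ length S
  length-boolFilter≤ p []       = ℕ.z≤n
  length-boolFilter≤ p (x ∷ xs) with p x
  ... | true  = ℕ.s≤s (length-boolFilter≤ p xs)
  ... | false = ℕₚ.m≤n⇒m≤1+n (length-boolFilter≤ p xs)

  length-boolFilter< : ∀ (p : Fin n → Bool) u S → memb u S ≡ true → p u ≡ false →
                       length (boolFilter p S) ℕ.< length S
  length-boolFilter< p u []       ()
  length-boolFilter< p u (x ∷ xs) u∈S pu with p x in px | u ≟ x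
  ... | true  | yes refl = contradiction (trans (sym px) pu) λ ()
  ... | false | yes refl = ℕ.s≤s (length-boolFilter≤ p xs)
  ... | true  | no _     = ℕ.s≤s (length-boolFilter< p u xs u∈S pu)
  ... | false | no _     = ℕₚ.m≤n⇒m≤1+n (length-boolFilter< p u xs u∈S pu)

  memb-tabulate : ∀ {m} (f : Fin m → Fin n) i → memb (f i) (tabulate f) ≡ true
  memb-tabulate f Fin.zero    = memb-here (f Fin.zero) (tabulate (f ∘ Fin.suc))
  memb-tabulate f (Fin.suc i) =
    memb-there (f (Fin.suc i)) (f Fin.zero) (tabulate (f ∘ Fin.suc)) (memb-tabulate (f ∘ Fin.suc) i)

  memb-tabulate-∉ : ∀ {m} (f : Fin m → Fin n) {v} → (∀ i → f i ≢ v) → memb v (tabulate f) ≡ false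
  memb-tabulate-∉ {ℕ.zero}  f f≢v = refl
  memb-tabulate-∉ {ℕ.suc m} f f≢v
    rewrite eqF-≢ (f≢v Fin.zero ∘ sym) = memb-tabulate-∉ (f ∘ Fin.suc) (f≢v ∘ Fin.suc)

  Nodup-tabulate : ∀ {m} (f : Fin m → Fin n) → (∀ {i j} → f i ≡ f j → i ≡ j) → Nodup (tabulate f)
  Nodup-tabulate {ℕ.zero}  f f-inj = []
  Nodup-tabulate {ℕ.suc m} f f-inj =
    memb-tabulate-∉ (f ∘ Fin.suc) (λ i eq → 0≢1+n (f-inj (sym eq)))
    ∷ Nodup-tabulate (f ∘ Fin.suc) (suc-injective ∘ f-inj)

  ∑-mono-≤-memb : ∀ (xs : List (Fin n)) {f g : Fin n → ℚ} →
                  (∀ x → memb x xs ≡ true → f x ≤ g x) → ∑ xs f ≤ ∑ xs g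
  ∑-mono-≤-memb []       f≤g = ≤-refl
  ∑-mono-≤-memb (x ∷ xs) f≤g =
    +-mono-≤ (f≤g x (memb-here x xs)) (∑-mono-≤-memb xs (λ y y∈xs → f≤g y (memb-there y x xs y∈xs)))

  δ-sym : ∀ (x u : Fin n) (f : Fin n → ℚ) → 𝟙 (eqF x u) * f u ≡ 𝟙 (eqF u x) * f x
  δ-sym x u f with x ≟ u
  ... | yes refl rewrite eqF-refl x = refl
  ... | no x≢u rewrite eqF-≢ (x≢u ∘ sym) = trans (*-zeroˡ (f u)) (sym (*-zeroˡ (f x)))

memb-allFin : ∀ {n} (u : Fin n) → memb u (allFin n) ≡ true
memb-allFin = memb-tabulate (λ u → u)

Nodup-allFin : ∀ n → Nodup (allFin n)
Nodup-allFin n = Nodup-tabulate (λ u → u) (λ eq → eq)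

∑-restrict : ∀ {n} {S : List (Fin n)} → Nodup S → (f : Fin n → ℚ) →
             ∑ S f ≡ ∑[ x ∈ allFin n ] (𝟙 (memb x S) * f x)
∑-restrict {n} {S} nd f = sym (begin
  ∑[ x ∈ Fn ] (𝟙 (memb x S) * f x)             ≡⟨ ∑-cong Fn (λ x → sym (∑-δ x f nd)) ⟩
  ∑[ x ∈ Fn ] ∑[ u ∈ S ] (𝟙 (eqF x u) * f u)   ≡⟨ ∑-comm Fn S _ ⟩
  ∑[ u ∈ S ] ∑[ x ∈ Fn ] (𝟙 (eqF x u) * f u)   ≡⟨ ∑-cong S (λ u → ∑-cong Fn (λ x → δ-sym x u f)) ⟩
  ∑[ u ∈ S ] ∑[ x ∈ Fn ] (𝟙 (eqF u x) * f x)   ≡⟨ ∑-cong S (λ u → ∑-δ u f (Nodup-allFin n)) ⟩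
  ∑[ u ∈ S ] (𝟙 (memb u Fn) * f u)             ≡⟨ ∑-cong S (λ u → cong (λ b → 𝟙 b * f u) (memb-allFin u)) ⟩
  ∑[ u ∈ S ] (1ℚ * f u)                        ≡⟨ ∑-cong S (λ u → *-identityˡ (f u)) ⟩
  ∑ S f                                         ∎)
  where
  open ≡-Reasoning
  Fn = allFin n

module _ {n : ℕ} where

  _≺_ : Fin n → Fin n → Bool
  a ≺ b = toℕ a <ᵇ toℕ b

  pairSum : (Fin n → Fin n → ℚ) → ℚ
  pairSum h = ∑[ a ∈ allFin n ] ∑[ b ∈ allFin n ] (𝟙 (a ≺ b) * h a b)

  𝟙≺+𝟙≻ : ∀ (h : Fin n → Fin n → ℚ) → (∀ a → h a a ≡ 0ℚ) →
          ∀ a b → (𝟙 (a ≺ b) + 𝟙 (b ≺ a)) * h a b ≡ h a b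
  𝟙≺+𝟙≻ h h-diag a b with ℕₚ.<-cmp (toℕ a) (toℕ b)
  ... | tri< a<b _ b≮a rewrite dec-true (toℕ a <? toℕ b) a<b | dec-false (toℕ b <? toℕ a) b≮a =
    *-identityˡ (h a b)
  ... | tri> a≮b _ b<a rewrite dec-false (toℕ a <? toℕ b) a≮b | dec-true (toℕ b <? toℕ a) b<a =
    *-identityˡ (h a b)
  ... | tri≈ _ a≡b _ rewrite toℕ-injective a≡b | h-diag b = *-zeroʳ (𝟙 (b ≺ b) + 𝟙 (b ≺ b))

  pairSum-double : ∀ (h : Fin n → Fin n → ℚ) → (∀ a b → h a b ≡ h b a) → (∀ a → h a a ≡ 0ℚ) →
                   pairSum h + pairSum h ≡ ∑[ a ∈ allFin n ] ∑[ b ∈ allFin n ] h a b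
  pairSum-double h h-sym h-diag = begin
    pairSum h + pairSum h
      ≡⟨ cong (pairSum h +_)
           (trans (∑-comm Fn Fn _) (∑-cong Fn (λ a → ∑-cong Fn (λ b → cong (𝟙 (b ≺ a) *_) (h-sym b a))))) ⟩
    pairSum h + ∑[ a ∈ Fn ] ∑[ b ∈ Fn ] (𝟙 (b ≺ a) * h a b)
      ≡⟨ ∑-distrib-+ Fn _ _ ⟨
    ∑[ a ∈ Fn ] (∑[ b ∈ Fn ] (𝟙 (a ≺ b) * h a b) + ∑[ b ∈ Fn ] (𝟙 (b ≺ a) * h a b))
      ≡⟨ ∑-cong Fn (λ a → ∑-distrib-+ Fn _ _) ⟨
    ∑[ a ∈ Fn ] ∑[ b ∈ Fn ] (𝟙 (a ≺ b) * h a b + 𝟙 (b ≺ a) * h a b)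
      ≡⟨ ∑-cong Fn (λ a → ∑-cong Fn (λ b →
           trans (sym (*-distribʳ-+ (h a b) (𝟙 (a ≺ b)) (𝟙 (b ≺ a)))) (𝟙≺+𝟙≻ h h-diag a b))) ⟩
    ∑[ a ∈ Fn ] ∑[ b ∈ Fn ] h a b ∎
    where
    open ≡-Reasoning
    Fn = allFin n

  pairSum-mono : ∀ {h h′ : Fin n → Fin n → ℚ} → (∀ a b → a ≺ b ≡ true → h a b ≤ h′ a b) →
                 pairSum h ≤ pairSum h′
  pairSum-mono {h} {h′} h≤h′ = ∑-mono-≤ (allFin n) (λ a → ∑-mono-≤ (allFin n) (λ b → termwise a b))
    where
    termwise : ∀ a b → 𝟙 (a ≺ b) * h a b ≤ 𝟙 (a ≺ b) * h′ a b
    termwise a b with a ≺ b in a≺b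
    ... | true  = *-monoˡ-≤-0≤ (0≤𝟙 true) (h≤h′ a b a≺b)
    ... | false = ≤-reflexive (trans (*-zeroˡ (h a b)) (sym (*-zeroˡ (h′ a b))))

  𝔼-pairSum : ∀ {A : Set} (D : List (ℚ × A)) (h : Fin n → Fin n → A → ℚ) →
              𝔼 D (λ x → pairSum (λ a b → h a b x)) ≡ pairSum (λ a b → 𝔼 D (h a b))
  𝔼-pairSum D h = trans (𝔼-∑ D (allFin n) _) (∑-cong (allFin n) (λ a →
    trans (𝔼-∑ D (allFin n) _) (∑-cong (allFin n) (λ b → 𝔼-*ˡ D (𝟙 (a ≺ b)) (h a b)))))

  ≺⇒≢ : ∀ {a b} → a ≺ b ≡ true → a ≢ b
  ≺⇒≢ {a} a≺b refl = ℕₚ.<-irrefl refl (ℕₚ.<ᵇ⇒< (toℕ a) (toℕ a) (subst T (sym a≺b) _))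

cost≡pairSum : ∀ {n} (G : Graph n) (ω : Weights n) same →
               cost G ω same ≡ pairSum (λ a b → ω a * ω b * 𝟙 (G a b xor same a b))
cost≡pairSum {n} G ω same = begin
  cost G ω same
    ≡⟨ cong sumℚ (List.map-id (concatMap row (allFin n))) ⟨
  ∑ (concatMap row (allFin n)) (λ q → q)
    ≡⟨ ∑-concatMap (allFin n) row (λ q → q) ⟩
  ∑[ a ∈ allFin n ] ∑ (row a) (λ q → q)
    ≡⟨ ∑-cong (allFin n) (λ a → trans (∑-map (allFin n) (entry a) (λ q → q))
                                       (∑-cong (allFin n) (λ b → if-∧-as-𝟙 (a ≺ b) _ (ω a * ω b)))) ⟩
  pairSum (λ a b → ω a * ω b * 𝟙 (G a b xor same a b)) ∎
  where
  open ≡-Reasoning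
  entry : Fin n → Fin n → ℚ
  entry a b = if (a ≺ b) ∧ (G a b xor same a b) then ω a * ω b else 0ℚ
  row : Fin n → List ℚ
  row a = map (entry a) (allFin n)

divOr0-pos : ∀ p {q} (0<q : 0ℚ < q) → divOr0 p q ≡ (p * (1/ q) {{pos⇒nonZero q {{positive 0<q}}}})
divOr0-pos p {mkℚ (ℤ.+ zero)  _ _} (*<* (ℤ.+<+ ()))
divOr0-pos p {mkℚ (ℤ.+ suc _) _ _} _  = refl
divOr0-pos p {mkℚ ℤ.-[1+ _ ]  _ _} (*<* ())

module _ {q : ℚ} (0<q : 0ℚ < q) where

  private instance
    q≢0 = pos⇒nonZero q {{positive 0<q}}

  divOr0≡*divOr0-1 : ∀ p → divOr0 p q ≡ p * divOr0 1ℚ q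
  divOr0≡*divOr0-1 p = trans (divOr0-pos p 0<q) (cong (p *_) (sym (trans (divOr0-pos 1ℚ 0<q) (*-identityˡ _))))

  0≤divOr0 : ∀ {p} → 0ℚ ≤ p → 0ℚ ≤ divOr0 p q
  0≤divOr0 0≤p = subst (0ℚ ≤_) (sym (divOr0-pos _ 0<q))
    (0≤* 0≤p (<⇒≤ (positive⁻¹ (1/ q) {{1/pos⇒pos q {{positive 0<q}}}})))

  ∑-divOr0 : ∀ {A : Set} (xs : List A) (f : A → ℚ) → ∑[ x ∈ xs ] divOr0 (f x) q ≡ divOr0 (∑ xs f) q
  ∑-divOr0 xs f = trans (∑-cong xs (λ x → divOr0-pos (f x) 0<q))
                        (trans (∑-*ʳ xs (1/ q) f) (sym (divOr0-pos (∑ xs f) 0<q)))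

  divOr0-self : divOr0 q q ≡ 1ℚ
  divOr0-self = trans (divOr0-pos q 0<q) (*-inverseʳ q)

∧-∧-false : ∀ p q x y → p ∧ q ≡ false → (p ∧ x) ∧ (q ∧ y) ≡ false
∧-∧-false false q     x y _  = refl
∧-∧-false true  false x y _  = ∧-zeroʳ x
∧-∧-false true  true  x y ()

∧-not-∧-false : ∀ p q x y → x ∨ y ≡ true → (p ∧ not (p ∧ x)) ∧ (q ∧ not (q ∧ y)) ≡ false
∧-not-∧-false false q     x     y     _ = refl
∧-not-∧-false true  false x     y     _ = ∧-zeroʳ (not x)
∧-not-∧-false true  true  true  y     _ = refl
∧-not-∧-false true  true  false true  _ = refl
∧-not-∧-false true  true  false false ()

∨-∨-weaken : ∀ e₁ e₂ g₁ g₂ → g₁ ∨ g₂ ≡ true → (e₁ ∨ g₁) ∨ (e₂ ∨ g₂) ≡ true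
∨-∨-weaken e₁ e₂ true  g₂    _ = cong (_∨ (e₂ ∨ g₂)) (∨-zeroʳ e₁)
∨-∨-weaken e₁ e₂ false true  _ =
  trans (cong ((e₁ ∨ false) ∨_) (∨-zeroʳ e₂)) (∨-zeroʳ (e₁ ∨ false))
∨-∨-weaken e₁ e₂ false false ()

xor-false⇒≡ : ∀ p q → p xor q ≡ false → p ≡ q
xor-false⇒≡ true  true  _ = refl
xor-false⇒≡ false false _ = refl

twoOfThree : Bool → Bool → Bool → Bool
twoOfThree true  true  r = not r
twoOfThree true  false r = r
twoOfThree false true  r = r
twoOfThree false false r = false

twoOfThree-swap₁₂ : ∀ p q r → twoOfThree p q r ≡ twoOfThree q p r
twoOfThree-swap₁₂ true  true  r = refl
twoOfThree-swap₁₂ true  false r = refl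
twoOfThree-swap₁₂ false true  r = refl
twoOfThree-swap₁₂ false false r = refl

twoOfThree-swap₂₃ : ∀ p q r → twoOfThree p q r ≡ twoOfThree p r q
twoOfThree-swap₂₃ true  true  true  = refl
twoOfThree-swap₂₃ true  true  false = refl
twoOfThree-swap₂₃ true  false true  = refl
twoOfThree-swap₂₃ true  false false = refl
twoOfThree-swap₂₃ false true  true  = refl
twoOfThree-swap₂₃ false true  false = refl
twoOfThree-swap₂₃ false false true  = refl
twoOfThree-swap₂₃ false false false = refl

twoOfThree⇒∨ : ∀ p q r → twoOfThree p q r ≡ true → q ∨ r ≡ true
twoOfThree⇒∨ true  true  r     _ = refl
twoOfThree⇒∨ true  false true  _ = refl
twoOfThree⇒∨ false true  r     _ = refl
twoOfThree⇒∨ false false r     ()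

xor-∧⇒twoOfThree : ∀ p q r → q ∨ r ≡ true → p xor (q ∧ r) ≡ true → twoOfThree p q r ≡ true
xor-∧⇒twoOfThree true  true  true  _  ()
xor-∧⇒twoOfThree false true  true  _  _  = refl
xor-∧⇒twoOfThree true  true  false _  _  = refl
xor-∧⇒twoOfThree false true  false _  ()
xor-∧⇒twoOfThree true  false true  _  _  = refl
xor-∧⇒twoOfThree false false true  _  ()
xor-∧⇒twoOfThree p     false false () _

twoOfThree-transitive : ∀ p q r → (p ≡ true → q ≡ true → r ≡ true) →
                        (p ≡ true → r ≡ true → q ≡ true) → (q ≡ true → r ≡ true → p ≡ true) →
                        twoOfThree p q r ≡ false
twoOfThree-transitive true  true  true  _ _ _ = refl
twoOfThree-transitive true  true  false t _ _ with t refl refl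
... | ()
twoOfThree-transitive true  false true  _ t _ with t refl refl
... | ()
twoOfThree-transitive true  false false _ _ _ = refl
twoOfThree-transitive false true  true  _ _ t with t refl refl
... | ()
twoOfThree-transitive false true  false _ _ _ = refl
twoOfThree-transitive false false r     _ _ _ = refl

twoOfThree-eqF : ∀ {m} (x y z : Fin m) → twoOfThree (eqF x y) (eqF x z) (eqF y z) ≡ false
twoOfThree-eqF x y z = twoOfThree-transitive (eqF x y) (eqF x z) (eqF y z)
  (λ x≡y x≡z → subst₂ (λ u v → eqF u v ≡ true) (eqF⇒≡ x y x≡y) (eqF⇒≡ x z x≡z) (eqF-refl x))
  (λ x≡y y≡z → subst (λ v → eqF x v ≡ true) (eqF⇒≡ y z y≡z) x≡y)
  (λ x≡z y≡z → subst (λ v → eqF x v ≡ true) (sym (eqF⇒≡ y z y≡z)) x≡z)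

twoOfThree-xor : ∀ {g₁ g₂ g₃ s₁ s₂ s₃} → twoOfThree g₁ g₂ g₃ ≡ true →
                 twoOfThree s₁ s₂ s₃ ≡ false → (g₁ xor s₁) ∨ ((g₂ xor s₂) ∨ (g₃ xor s₃)) ≡ true
twoOfThree-xor {g₁} {g₂} {g₃} {s₁} {s₂} {s₃} g-two s-not-two
  with g₁ xor s₁ in e₁ | g₂ xor s₂ in e₂ | g₃ xor s₃ in e₃
... | true  | _     | _     = refl
... | false | true  | _     = refl
... | false | false | true  = refl
... | false | false | false
  with refl ← xor-false⇒≡ g₁ s₁ e₁ | refl ← xor-false⇒≡ g₂ s₂ e₂ | refl ← xor-false⇒≡ g₃ s₃ e₃ =
  contradiction (trans (sym g-two) s-not-two) λ ()

module Pivot {n : ℕ} (G : Graph n) (ω : Weights n) (ω-pos : ∀ u → 0ℚ < ω u) where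

  W : List (Fin n) → ℚ
  W S = totalWeight ω S

  joins : Fin n → Fin n → Bool
  joins u v = eqF v u ∨ G u v

  cluster : Fin n → List (Fin n) → List (Fin n)
  cluster u S = boolFilter (joins u) S

  rest : Fin n → List (Fin n) → List (Fin n)
  rest u S = boolFilter (λ v → not (memb v (cluster u S))) S

  prob : Fin n → List (Fin n) → ℚ
  prob u S = divOr0 (ω u) (W S)

  0<W : ∀ s ss → 0ℚ < W (s ∷ ss)
  0<W s ss =
    subst (_< W (s ∷ ss)) (+-identityʳ 0ℚ) (+-mono-<-≤ (ω-pos s) (0≤∑ ss (λ u → <⇒≤ (ω-pos u))))

  0≤prob : ∀ u s ss → 0ℚ ≤ prob u (s ∷ ss)
  0≤prob u s ss = 0≤divOr0 (0<W s ss) (<⇒≤ (ω-pos u))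

  ∑-prob : ∀ s ss → ∑[ u ∈ s ∷ ss ] prob u (s ∷ ss) ≡ 1ℚ
  ∑-prob s ss = trans (∑-divOr0 (0<W s ss) (s ∷ ss) ω) (divOr0-self (0<W s ss))

  ∑-prob-* : ∀ s ss c → ∑[ u ∈ s ∷ ss ] (prob u (s ∷ ss) * c) ≡ c
  ∑-prob-* s ss c =
    trans (∑-*ʳ (s ∷ ss) c (λ u → prob u (s ∷ ss))) (trans (cong (_* c) (∑-prob s ss)) (*-identityˡ c))

  𝔼ᵖ : ℕ → List (Fin n) → (Clusters n → ℚ) → ℚ
  𝔼ᵖ k S = 𝔼 (pivotDist G ω k S)

  𝔼ᵖ-step : ∀ k s ss f → let S = s ∷ ss in
            𝔼ᵖ (suc k) S f ≡ ∑[ u ∈ S ] (prob u S * 𝔼ᵖ k (rest u S) (λ cl → f (cluster u S ∷ cl)))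
  𝔼ᵖ-step k s ss f = begin
    ∑ (concatMap branch S) term                   ≡⟨ ∑-concatMap S branch term ⟩
    ∑[ u ∈ S ] ∑ (branch u) term                  ≡⟨ ∑-cong S (λ u → ∑-map (D u) (extend u) term) ⟩
    ∑[ u ∈ S ] ∑[ pc ∈ D u ] (prob u S * proj₁ pc * f (cluster u S ∷ proj₂ pc))
      ≡⟨ ∑-cong S (λ u → trans (∑-cong (D u) (λ pc → *-assoc (prob u S) (proj₁ pc) _))
                                (∑-*ˡ (D u) (prob u S) (λ pc → proj₁ pc * f (cluster u S ∷ proj₂ pc)))) ⟩
    ∑[ u ∈ S ] (prob u S * 𝔼ᵖ k (rest u S) (λ cl → f (cluster u S ∷ cl))) ∎
    where
    open ≡-Reasoning
    S = s ∷ ss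
    D : Fin n → List (ℚ × Clusters n)
    D u = pivotDist G ω k (rest u S)
    extend : Fin n → ℚ × Clusters n → ℚ × Clusters n
    extend u (p , cl) = (prob u S * p , cluster u S ∷ cl)
    branch : Fin n → List (ℚ × Clusters n)
    branch u = map (extend u) (D u)
    term : ℚ × Clusters n → ℚ
    term pc = proj₁ pc * f (proj₂ pc)

  𝔼ᵖ-cong : ∀ k S {f g : Clusters n → ℚ} → (∀ cl → f cl ≡ g cl) → 𝔼ᵖ k S f ≡ 𝔼ᵖ k S g
  𝔼ᵖ-cong k S = 𝔼-cong (pivotDist G ω k S)

  memb-cluster : ∀ v u S → memb v (cluster u S) ≡ memb v S ∧ joins u v
  memb-cluster v u S = memb-boolFilter v (joins u) S

  memb-rest : ∀ v u S → memb v (rest u S) ≡ memb v S ∧ not (memb v (cluster u S))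
  memb-rest v u S = memb-boolFilter v (λ w → not (memb w (cluster u S))) S

  memb-cluster-∈ : ∀ v u S → memb v S ≡ true → memb v (cluster u S) ≡ joins u v
  memb-cluster-∈ v u S v∈S = trans (memb-cluster v u S) (cong (_∧ joins u v) v∈S)

  memb-rest-∈ : ∀ v u S → memb v S ≡ true → memb v (rest u S) ≡ not (joins u v)
  memb-rest-∈ v u S v∈S = trans (memb-rest v u S)
    (trans (cong (_∧ not (memb v (cluster u S))) v∈S) (cong not (memb-cluster-∈ v u S v∈S)))

  rest-shorter : ∀ u S → memb u S ≡ true → length (rest u S) ℕ.< length S
  rest-shorter u S u∈S = length-boolFilter< (λ v → not (memb v (cluster u S))) u S u∈S
    (cong not (trans (memb-cluster-∈ u u S u∈S) (cong (_∨ G u u) (eqF-refl u))))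

  rest-apart : ∀ u S a b → memb a S ∧ memb b S ≡ false →
               memb a (rest u S) ∧ memb b (rest u S) ≡ false
  rest-apart u S a b a,b∉S rewrite memb-rest a u S | memb-rest b u S =
    ∧-∧-false (memb a S) (memb b S) (not (memb a (cluster u S))) (not (memb b (cluster u S))) a,b∉S

  cluster-apart : ∀ u S a b → memb a S ∧ memb b S ≡ false →
                  memb a (cluster u S) ∧ memb b (cluster u S) ≡ false
  cluster-apart u S a b a,b∉S rewrite memb-cluster a u S | memb-cluster b u S =
    ∧-∧-false (memb a S) (memb b S) (joins u a) (joins u b) a,b∉S

  joined⇒rest-apart : ∀ u S a b → joins u a ∨ joins u b ≡ true →
                      memb a (rest u S) ∧ memb b (rest u S) ≡ false
  joined⇒rest-apart u S a b joined
    rewrite memb-rest a u S | memb-rest b u S | memb-cluster a u S | memb-cluster b u S =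
    ∧-not-∧-false (memb a S) (memb b S) (joins u a) (joins u b) joined

  𝔼ᵖ-apart : ∀ k S a b (F : Bool → ℚ) → memb a S ∧ memb b S ≡ false →
             𝔼ᵖ k S (λ cl → F (sameClusters cl a b)) ≡ F false
  𝔼ᵖ-apart zero    S        a b F _ = 𝔼-point [] (λ cl → F (sameClusters cl a b))
  𝔼ᵖ-apart (suc k) []       a b F _ = 𝔼-point [] (λ cl → F (sameClusters cl a b))
  𝔼ᵖ-apart (suc k) (s ∷ ss) a b F a,b∉S = trans (𝔼ᵖ-step k s ss _) (trans (∑-cong (s ∷ ss) λ u →
      cong (prob u (s ∷ ss) *_) (trans
        (𝔼ᵖ-cong k _ (λ cl → cong (λ t → F (t ∨ sameClusters cl a b)) (cluster-apart u (s ∷ ss) a b a,b∉S)))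
        (𝔼ᵖ-apart k (rest u (s ∷ ss)) a b F (rest-apart u (s ∷ ss) a b a,b∉S))))
    (∑-prob-* s ss (F false)))

module Charging {n : ℕ} (G : Graph n) (ω : Weights n) (ω-pos : ∀ u → 0ℚ < ω u)
                (G-sym : ∀ u v → G u v ≡ G v u) where
  open Pivot G ω ω-pos

  distinct₃ : Fin n → Fin n → Fin n → Bool
  distinct₃ a b x = not (eqF a b) ∧ (not (eqF a x) ∧ not (eqF b x))

  badTriangle : Fin n → Fin n → Fin n → Bool
  badTriangle a b x = distinct₃ a b x ∧ twoOfThree (G a b) (G a x) (G b x)

  badTriangle-swap₁₂ : ∀ a b x → badTriangle a b x ≡ badTriangle b a x
  badTriangle-swap₁₂ a b x = cong₂ _∧_
    (cong₂ _∧_ (cong not (eqF-sym a b)) (∧-comm (not (eqF a x)) (not (eqF b x))))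
    (trans (twoOfThree-swap₂₃ (G a b) (G a x) (G b x)) (cong (λ g → twoOfThree g (G b x) (G a x)) (G-sym a b)))

  badTriangle-swap₂₃ : ∀ a b x → badTriangle a b x ≡ badTriangle a x b
  badTriangle-swap₂₃ a b x = cong₂ _∧_
    (trans (𝔹∧.x∙yz≈y∙xz (not (eqF a b)) (not (eqF a x)) (not (eqF b x)))
           (cong (λ e → not (eqF a x) ∧ (not (eqF a b) ∧ not e)) (eqF-sym b x)))
    (trans (twoOfThree-swap₁₂ (G a b) (G a x) (G b x)) (cong (twoOfThree (G a x) (G a b)) (G-sym b x)))

  alive₃ : List (Fin n) → Fin n → Fin n → Fin n → Bool
  alive₃ S a b x = memb a S ∧ (memb b S ∧ memb x S)

  -- ω x * exposure k S a b x is the probability that x is chosen as a pivot while a, b and x are all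
  -- unclustered: in each round, ω x / W is the probability that x is the next pivot.
  exposure : ℕ → List (Fin n) → Fin n → Fin n → Fin n → ℚ
  exposure zero    _        a b x = 0ℚ
  exposure (suc k) []       a b x = 0ℚ
  exposure (suc k) (s ∷ ss) a b x =
    divOr0 1ℚ (W (s ∷ ss)) * 𝟙 (alive₃ (s ∷ ss) a b x)
    + ∑[ u ∈ s ∷ ss ] (prob u (s ∷ ss) * exposure k (rest u (s ∷ ss)) a b x)

  exposure-cong : ∀ {a b x a′ b′ x′} → (∀ S → alive₃ S a b x ≡ alive₃ S a′ b′ x′) →
                  ∀ k S → exposure k S a b x ≡ exposure k S a′ b′ x′
  exposure-cong same zero    S        = refl
  exposure-cong same (suc k) []       = refl
  exposure-cong same (suc k) (s ∷ ss) = cong₂ _+_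
    (cong (λ t → divOr0 1ℚ (W (s ∷ ss)) * 𝟙 t) (same (s ∷ ss)))
    (∑-cong (s ∷ ss) (λ u → cong (prob u (s ∷ ss) *_) (exposure-cong same k (rest u (s ∷ ss)))))

  exposure-swap₁₂ : ∀ k S a b x → exposure k S a b x ≡ exposure k S b a x
  exposure-swap₁₂ k S a b x = exposure-cong (λ S → 𝔹∧.x∙yz≈y∙xz (memb a S) (memb b S) (memb x S)) k S

  exposure-swap₂₃ : ∀ k S a b x → exposure k S a b x ≡ exposure k S a x b
  exposure-swap₂₃ k S a b x = exposure-cong (λ S → 𝔹∧.x∙yz≈x∙zy (memb a S) (memb b S) (memb x S)) k S

  0≤exposure : ∀ k S a b x → 0ℚ ≤ exposure k S a b x
  0≤exposure zero    S        a b x = ≤-refl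
  0≤exposure (suc k) []       a b x = ≤-refl
  0≤exposure (suc k) (s ∷ ss) a b x = subst (_≤ exposure (suc k) (s ∷ ss) a b x) (+-identityʳ 0ℚ)
    (+-mono-≤ (0≤* (0≤divOr0 (0<W s ss) (≤ᵇ⇒≤ _)) (0≤𝟙 (alive₃ (s ∷ ss) a b x)))
              (0≤∑ (s ∷ ss) (λ u → 0≤* (0≤prob u s ss) (0≤exposure k _ a b x))))

  charge : ℕ → List (Fin n) → Fin n → Fin n → ℚ
  charge k S a b = ∑[ x ∈ allFin n ] (𝟙 (badTriangle a b x) * (ω x * exposure k S a b x))

  0≤charge : ∀ k S a b → 0ℚ ≤ charge k S a b
  0≤charge k S a b =
    0≤∑ (allFin n) (λ x → 0≤* (0≤𝟙 (badTriangle a b x)) (0≤* (<⇒≤ (ω-pos x)) (0≤exposure k S a b x)))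

  ∑-next-pivot : ∀ s ss a b → Nodup (s ∷ ss) → let S = s ∷ ss in
                 ∑[ x ∈ allFin n ] (𝟙 (badTriangle a b x) * (ω x * (divOr0 1ℚ (W S) * 𝟙 (alive₃ S a b x))))
                 ≡ ∑[ u ∈ S ] (prob u S * 𝟙 (badTriangle a b u ∧ (memb a S ∧ memb b S)))
  ∑-next-pivot s ss a b nd = sym (trans (∑-restrict nd _) (∑-cong (allFin n) termwise))
    where
    open +-*-Solver
    S = s ∷ ss
    c = memb a S ∧ memb b S
    termwise : ∀ x → 𝟙 (memb x S) * (prob x S * 𝟙 (badTriangle a b x ∧ c)) ≡
                     𝟙 (badTriangle a b x) * (ω x * (divOr0 1ℚ (W S) * 𝟙 (alive₃ S a b x)))
    termwise x rewrite divOr0≡*divOr0-1 (0<W s ss) (ω x) | 𝟙-∧ (badTriangle a b x) c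
                     | 𝟙-∧ (memb a S) (memb b S) | 𝟙-∧ (memb a S) (memb b S ∧ memb x S)
                     | 𝟙-∧ (memb b S) (memb x S) =
      solve 6 (λ ξ w i β α γ → ξ :* (w :* i :* (β :* (α :* γ))) := β :* (w :* (i :* (α :* (γ :* ξ)))))
        refl (𝟙 (memb x S)) (ω x) (divOr0 1ℚ (W S)) (𝟙 (badTriangle a b x)) (𝟙 (memb a S)) (𝟙 (memb b S))

  charge-step : ∀ k s ss a b → Nodup (s ∷ ss) → let S = s ∷ ss in
                charge (suc k) S a b ≡
                ∑[ u ∈ S ] (prob u S * (𝟙 (badTriangle a b u ∧ (memb a S ∧ memb b S))
                                        + charge k (rest u S) a b))
  charge-step k s ss a b nd = begin
    charge (suc k) S a b
      ≡⟨ ∑-cong (allFin n) split ⟩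
    ∑[ x ∈ allFin n ] (now x + ∑[ u ∈ S ] (prob u S * later u x))
      ≡⟨ ∑-distrib-+ (allFin n) now _ ⟩
    ∑ (allFin n) now + ∑[ x ∈ allFin n ] ∑[ u ∈ S ] (prob u S * later u x)
      ≡⟨ cong₂ _+_ (∑-next-pivot s ss a b nd)
           (trans (∑-comm (allFin n) S _) (∑-cong S (λ u → ∑-*ˡ (allFin n) (prob u S) (later u)))) ⟩
    ∑[ u ∈ S ] (prob u S * 𝟙 (badTriangle a b u ∧ c)) + ∑[ u ∈ S ] (prob u S * charge k (rest u S) a b)
      ≡⟨ ∑-distrib-+ S (λ u → prob u S * 𝟙 (badTriangle a b u ∧ c)) (λ u → prob u S * charge k (rest u S) a b)
       ⟨
    ∑[ u ∈ S ] (prob u S * 𝟙 (badTriangle a b u ∧ c) + prob u S * charge k (rest u S) a b)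
      ≡⟨ ∑-cong S (λ u → *-distribˡ-+ (prob u S) _ _) ⟨
    ∑[ u ∈ S ] (prob u S * (𝟙 (badTriangle a b u ∧ c) + charge k (rest u S) a b)) ∎
    where
    open ≡-Reasoning
    S = s ∷ ss
    c = memb a S ∧ memb b S
    i = divOr0 1ℚ (W S)
    now : Fin n → ℚ
    now x = 𝟙 (badTriangle a b x) * (ω x * (i * 𝟙 (alive₃ S a b x)))
    later : Fin n → Fin n → ℚ
    later u x = 𝟙 (badTriangle a b x) * (ω x * exposure k (rest u S) a b x)
    split : ∀ x → 𝟙 (badTriangle a b x) * (ω x * exposure (suc k) S a b x)
                  ≡ now x + ∑[ u ∈ S ] (prob u S * later u x)
    split x = begin
      β * (ω x * (i * 𝟙 (alive₃ S a b x) + ∑[ u ∈ S ] (prob u S * e u)))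
        ≡⟨ trans (cong (β *_) (*-distribˡ-+ (ω x) _ _)) (*-distribˡ-+ β _ _) ⟩
      now x + β * (ω x * ∑[ u ∈ S ] (prob u S * e u))
        ≡⟨ cong (λ t → now x + β * t) (∑-*ˡ S (ω x) _) ⟨
      now x + β * ∑[ u ∈ S ] (ω x * (prob u S * e u))
        ≡⟨ cong (now x +_) (∑-*ˡ S β _) ⟨
      now x + ∑[ u ∈ S ] (β * (ω x * (prob u S * e u)))
        ≡⟨ cong (now x +_) (∑-cong S (λ u → trans (cong (β *_) (ℚ*.x∙yz≈y∙xz (ω x) (prob u S) (e u)))
                                                  (ℚ*.x∙yz≈y∙xz β (prob u S) (ω x * e u)))) ⟩
      now x + ∑[ u ∈ S ] (prob u S * later u x) ∎
      where
      β = 𝟙 (badTriangle a b x)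
      e = λ u → exposure k (rest u S) a b x

  badTriangle⇒joined : ∀ a b u → badTriangle a b u ≡ true → joins u a ∨ joins u b ≡ true
  badTriangle⇒joined a b u bad rewrite G-sym u a | G-sym u b =
    ∨-∨-weaken (eqF a u) (eqF b u) (G a u) (G b u)
      (twoOfThree⇒∨ (G a b) (G a u) (G b u) (∧-conicalʳ (distinct₃ a b u) _ bad))

  charge-stopped : ∀ k S a b → (∀ x → exposure k S a b x ≡ 0ℚ) → charge k S a b ≡ 0ℚ
  charge-stopped k S a b stopped = trans (∑-cong (allFin n) (λ x →
      trans (cong (λ e → 𝟙 (badTriangle a b x) * (ω x * e)) (stopped x))
            (trans (cong (𝟙 (badTriangle a b x) *_) (*-zeroʳ (ω x))) (*-zeroʳ (𝟙 (badTriangle a b x))))))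
    (∑-zero (allFin n))

  charge≤𝟙 : ∀ k S a b → Nodup S → charge k S a b ≤ 𝟙 (memb a S ∧ memb b S)
  charge≤𝟙 zero    S        a b _  =
    ≤-trans (≤-reflexive (charge-stopped zero S a b (λ _ → refl))) (0≤𝟙 (memb a S ∧ memb b S))
  charge≤𝟙 (suc k) []       a b _  = ≤-reflexive (charge-stopped (suc k) [] a b (λ _ → refl))
  charge≤𝟙 (suc k) (s ∷ ss) a b nd = begin
    charge (suc k) S a b
      ≡⟨ charge-step k s ss a b nd ⟩
    ∑[ u ∈ S ] (prob u S * (𝟙 (badTriangle a b u ∧ c) + charge k (rest u S) a b))
      ≤⟨ ∑-mono-≤ S (λ u → *-monoˡ-≤-0≤ (0≤prob u s ss) (charged-once u)) ⟩
    ∑[ u ∈ S ] (prob u S * 𝟙 c)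
      ≡⟨ ∑-prob-* s ss (𝟙 c) ⟩
    𝟙 c ∎
    where
    open ≤-Reasoning
    S = s ∷ ss
    c = memb a S ∧ memb b S
    charged-once : ∀ u → 𝟙 (badTriangle a b u ∧ c) + charge k (rest u S) a b ≤ 𝟙 c
    charged-once u = ≤-trans
      (+-monoʳ-≤ (𝟙 (badTriangle a b u ∧ c)) (charge≤𝟙 k (rest u S) a b (Nodup-boolFilter _ nd)))
      (𝟙+𝟙≤𝟙 (badTriangle a b u ∧ c) (memb a (rest u S) ∧ memb b (rest u S)) c
        (λ c≡false → trans (cong (badTriangle a b u ∧_) c≡false) (∧-zeroʳ _))
        (rest-apart u S a b)
        (λ bad → joined⇒rest-apart u S a b (badTriangle⇒joined a b u (∧-conicalˡ _ c bad))))

  wrongly-decided⇒badTriangle : ∀ a b u → a ≢ b → joins u a ∨ joins u b ≡ true →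
                                G a b xor (joins u a ∧ joins u b) ≡ true → badTriangle a b u ≡ true
  wrongly-decided⇒badTriangle a b u a≢b joined wrong with u ≟ a | u ≟ b
  ... | yes refl | _ rewrite eqF-refl u | eqF-≢ (a≢b ∘ sym) =
    contradiction (trans (sym wrong) (xor-same (G u b))) λ ()
  ... | no u≢a | yes refl rewrite eqF-refl u | eqF-≢ a≢b | G-sym u a | ∧-identityʳ (G a u) =
    contradiction (trans (sym wrong) (xor-same (G a u))) λ ()
  ... | no u≢a | no u≢b
    rewrite eqF-≢ a≢b | eqF-≢ (u≢a ∘ sym) | eqF-≢ (u≢b ∘ sym) | G-sym u a | G-sym u b =
    xor-∧⇒twoOfThree (G a b) (G a u) (G b u) joined wrong

  disagreement : Fin n → Fin n → Clusters n → ℚ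
  disagreement a b cl = 𝟙 (G a b xor sameClusters cl a b)

  𝔼ᵖ-joined : ∀ k u S a b → a ≢ b → memb a S ≡ true → memb b S ≡ true →
              joins u a ∨ joins u b ≡ true →
              𝔼ᵖ k (rest u S) (λ cl → disagreement a b (cluster u S ∷ cl)) ≤ 𝟙 (badTriangle a b u)
  𝔼ᵖ-joined k u S a b a≢b a∈S b∈S joined = begin
    𝔼ᵖ k (rest u S) (λ cl → disagreement a b (cluster u S ∷ cl))
      ≡⟨ 𝔼ᵖ-apart k (rest u S) a b (λ t → 𝟙 (G a b xor (a,b∈C ∨ t))) (joined⇒rest-apart u S a b joined) ⟩
    𝟙 (G a b xor (a,b∈C ∨ false))
      ≡⟨ cong (λ t → 𝟙 (G a b xor t))
           (trans (∨-identityʳ a,b∈C) (cong₂ _∧_ (memb-cluster-∈ a u S a∈S) (memb-cluster-∈ b u S b∈S))) ⟩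
    𝟙 (G a b xor (joins u a ∧ joins u b))
      ≤⟨ 𝟙-mono _ _ (wrongly-decided⇒badTriangle a b u a≢b joined) ⟩
    𝟙 (badTriangle a b u) ∎
    where
    open ≤-Reasoning
    a,b∈C = memb a (cluster u S) ∧ memb b (cluster u S)

  𝔼ᵖ-missed : ∀ k u S a b → memb a S ≡ true → memb b S ≡ true → joins u a ≡ false → joins u b ≡ false →
              𝔼ᵖ k (rest u S) (λ cl → disagreement a b (cluster u S ∷ cl)) ≡ 𝔼ᵖ k (rest u S) (disagreement a b)
  𝔼ᵖ-missed k u S a b a∈S b∈S a-stays b-stays = 𝔼ᵖ-cong k (rest u S) (λ cl →
    cong (λ t → 𝟙 (G a b xor (t ∨ sameClusters cl a b)))
         (cong₂ _∧_ (trans (memb-cluster-∈ a u S a∈S) a-stays) (trans (memb-cluster-∈ b u S b∈S) b-stays)))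

  𝔼ᵖ-disagreement≤charge : ∀ k S a b → Nodup S → length S ℕ.≤ k → memb a S ≡ true → memb b S ≡ true →
                            a ≢ b → 𝔼ᵖ k S (disagreement a b) ≤ charge k S a b
  𝔼ᵖ-disagreement≤charge zero    (s ∷ ss) a b nd ()
  𝔼ᵖ-disagreement≤charge (suc k) (s ∷ ss) a b nd (ℕ.s≤s len) a∈S b∈S a≢b = begin
    𝔼ᵖ (suc k) S (disagreement a b)
      ≡⟨ 𝔼ᵖ-step k s ss (disagreement a b) ⟩
    ∑[ u ∈ S ] (prob u S * 𝔼ᵖ k (rest u S) (λ cl → disagreement a b (cluster u S ∷ cl)))
      ≤⟨ ∑-mono-≤-memb S (λ u u∈S → *-monoˡ-≤-0≤ (0≤prob u s ss) (pivot-round u u∈S)) ⟩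
    ∑[ u ∈ S ] (prob u S * (𝟙 (badTriangle a b u ∧ c) + charge k (rest u S) a b))
      ≡⟨ charge-step k s ss a b nd ⟨
    charge (suc k) S a b ∎
    where
    open ≤-Reasoning
    S = s ∷ ss
    c = memb a S ∧ memb b S
    pivot-round : ∀ u → memb u S ≡ true → 𝔼ᵖ k (rest u S) (λ cl → disagreement a b (cluster u S ∷ cl))
                                          ≤ 𝟙 (badTriangle a b u ∧ c) + charge k (rest u S) a b
    pivot-round u u∈S with joins u a ∨ joins u b in joined
    ... | true = begin
      𝔼ᵖ k (rest u S) (λ cl → disagreement a b (cluster u S ∷ cl))
        ≤⟨ 𝔼ᵖ-joined k u S a b a≢b a∈S b∈S joined ⟩
      𝟙 (badTriangle a b u)
        ≡⟨ cong 𝟙 bad∧c≡bad ⟨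
      𝟙 (badTriangle a b u ∧ c)
        ≤⟨ p≤p+q _ (0≤charge k (rest u S) a b) ⟩
      𝟙 (badTriangle a b u ∧ c) + charge k (rest u S) a b ∎
      where bad∧c≡bad = trans (cong (badTriangle a b u ∧_) (cong₂ _∧_ a∈S b∈S)) (∧-identityʳ _)
    ... | false = begin
      𝔼ᵖ k (rest u S) (λ cl → disagreement a b (cluster u S ∷ cl))
        ≡⟨ 𝔼ᵖ-missed k u S a b a∈S b∈S a-stays b-stays ⟩
      𝔼ᵖ k (rest u S) (disagreement a b)
        ≤⟨ 𝔼ᵖ-disagreement≤charge k (rest u S) a b (Nodup-boolFilter _ nd)
             (ℕₚ.≤-trans (ℕₚ.≤-pred (rest-shorter u S u∈S)) len)
             (trans (memb-rest-∈ a u S a∈S) (cong not a-stays)) (trans (memb-rest-∈ b u S b∈S) (cong not b-stays))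
             a≢b ⟩
      charge k (rest u S) a b
        ≤⟨ p≤q+p _ (0≤𝟙 (badTriangle a b u ∧ c)) ⟩
      𝟙 (badTriangle a b u ∧ c) + charge k (rest u S) a b ∎
      where
      a-stays = ∨-conicalˡ (joins u a) (joins u b) joined
      b-stays = ∨-conicalʳ (joins u a) (joins u b) joined

-- Opened only here: its prefix operator +_ would make sections such as (f x +_) above ambiguous.
open import Data.Integer using (+_)

module Approximation {n : ℕ} (G : Graph n) (ω : Weights n) (ω-pos : ∀ u → 0ℚ < ω u)
                     (G-sym : ∀ u v → G u v ≡ G v u) where
  open Pivot G ω ω-pos
  open Charging G ω ω-pos G-sym
  open +-*-Solver

  -- Unlike the summand ω x * exposure of charge, this is symmetric in a, b and x.
  triangleMass : Fin n → Fin n → Fin n → ℚ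
  triangleMass a b x = ω a * ω b * ω x * exposure n (allFin n) a b x

  0≤triangleMass : ∀ a b x → 0ℚ ≤ triangleMass a b x
  0≤triangleMass a b x = 0≤* (0≤* (0≤* (ω≥0 a) (ω≥0 b)) (ω≥0 x)) (0≤exposure n (allFin n) a b x)
    where ω≥0 = λ u → <⇒≤ (ω-pos u)

  triangleWeight : Fin n → Fin n → Fin n → ℚ
  triangleWeight a b x = 𝟙 (badTriangle a b x) * triangleMass a b x

  triangleWeight-swap₁₂ : ∀ a b x → triangleWeight a b x ≡ triangleWeight b a x
  triangleWeight-swap₁₂ a b x = cong₂ _*_ (cong 𝟙 (badTriangle-swap₁₂ a b x))
    (cong₂ _*_ (cong (_* ω x) (*-comm (ω a) (ω b))) (exposure-swap₁₂ n (allFin n) a b x))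

  triangleWeight-swap₂₃ : ∀ a b x → triangleWeight a b x ≡ triangleWeight a x b
  triangleWeight-swap₂₃ a b x = cong₂ _*_ (cong 𝟙 (badTriangle-swap₂₃ a b x))
    (cong₂ _*_ (solve 3 (λ p q r → p :* q :* r := p :* r :* q) refl (ω a) (ω b) (ω x))
               (exposure-swap₂₃ n (allFin n) a b x))

  triangleWeight-diag : ∀ a x → triangleWeight a a x ≡ 0ℚ
  triangleWeight-diag a x rewrite eqF-refl a = *-zeroˡ (ω a * ω a * ω x * exposure n (allFin n) a a x)

  pairCharge : Fin n → Fin n → ℚ
  pairCharge a b = ∑[ x ∈ allFin n ] triangleWeight a b x

  pairCharge≡ : ∀ a b → pairCharge a b ≡ ω a * ω b * charge n (allFin n) a b
  pairCharge≡ a b = trans (∑-cong (allFin n) (λ x →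
      solve 5 (λ β p q r e → β :* (p :* q :* r :* e) := p :* q :* (β :* (r :* e))) refl
              (𝟙 (badTriangle a b x)) (ω a) (ω b) (ω x) (exposure n (allFin n) a b x)))
    (∑-*ˡ (allFin n) (ω a * ω b) _)

  pairCharge-sym : ∀ a b → pairCharge a b ≡ pairCharge b a
  pairCharge-sym a b = ∑-cong (allFin n) (triangleWeight-swap₁₂ a b)

  pairCharge-diag : ∀ a → pairCharge a a ≡ 0ℚ
  pairCharge-diag a = trans (∑-cong (allFin n) (triangleWeight-diag a)) (∑-zero (allFin n))

  expectedPivotCost≤pairCharge : expectedPivotCost G ω ≤ pairSum pairCharge
  expectedPivotCost≤pairCharge = begin
    expectedPivotCost G ω
      ≡⟨ 𝔼-cong D (λ cl → cost≡pairSum G ω (sameClusters cl)) ⟩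
    𝔼 D (λ cl → pairSum (λ a b → ω a * ω b * disagreement a b cl))
      ≡⟨ 𝔼-pairSum D (λ a b cl → ω a * ω b * disagreement a b cl) ⟩
    pairSum (λ a b → 𝔼 D (λ cl → ω a * ω b * disagreement a b cl))
      ≤⟨ pairSum-mono pair-bound ⟩
    pairSum pairCharge ∎
    where
    open ≤-Reasoning
    D = pivotDist G ω n (allFin n)
    pair-bound : ∀ a b → a ≺ b ≡ true → 𝔼 D (λ cl → ω a * ω b * disagreement a b cl) ≤ pairCharge a b
    pair-bound a b a≺b = begin
      𝔼 D (λ cl → ω a * ω b * disagreement a b cl)  ≡⟨ 𝔼-*ˡ D (ω a * ω b) (disagreement a b) ⟩
      ω a * ω b * 𝔼 D (disagreement a b)
        ≤⟨ *-monoˡ-≤-0≤ (0≤* (<⇒≤ (ω-pos a)) (<⇒≤ (ω-pos b)))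
             (𝔼ᵖ-disagreement≤charge n (allFin n) a b (Nodup-allFin n)
               (ℕₚ.≤-reflexive (List.length-tabulate (λ u → u))) (memb-allFin a) (memb-allFin b) (≺⇒≢ a≺b)) ⟩
      ω a * ω b * charge n (allFin n) a b            ≡⟨ pairCharge≡ a b ⟨
      pairCharge a b                                  ∎

  module _ (L : Fin n → Fin n) where

    violated : Fin n → Fin n → Bool
    violated a b = G a b xor sameLabel L a b

    violated-sym : ∀ a b → violated a b ≡ violated b a
    violated-sym a b = cong₂ _xor_ (G-sym a b) (eqF-sym (L a) (L b))

    badTriangle-violated : ∀ a b x → badTriangle a b x ≡ true →
                           violated a b ∨ (violated a x ∨ violated b x) ≡ true
    badTriangle-violated a b x bad = twoOfThree-xor {G a b} {G a x} {G b x}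
      (∧-conicalʳ (distinct₃ a b x) _ bad) (twoOfThree-eqF (L a) (L b) (L x))

    violatedWeight : ℚ
    violatedWeight = ∑³ (allFin n) (λ a b x → 𝟙 (violated a b) * triangleWeight a b x)

    triangles≤3violated : ∑³ (allFin n) triangleWeight ≤ (+ 3 / 1) * violatedWeight
    triangles≤3violated = begin
      ∑³ Fn triangleWeight
        ≤⟨ ∑³-mono-≤ Fn (λ a b x → 𝟙-covered (badTriangle a b x) (v a b + v a x + v b x) (triangleMass a b x)
             (λ bad → 1≤𝟙+𝟙+𝟙 (violated a b) (violated a x) (violated b x) (badTriangle-violated a b x bad))
             (0≤triangleMass a b x)) ⟩
      ∑³ Fn (λ a b x → (v a b + v a x + v b x) * triangleWeight a b x)
        ≡⟨ ∑³-cong Fn (λ a b x → trans (*-distribʳ-+ (triangleWeight a b x) (v a b + v a x) (v b x))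
             (cong (_+ v b x * triangleWeight a b x) (*-distribʳ-+ (triangleWeight a b x) (v a b) (v a x)))) ⟩
      ∑³ Fn (λ a b x → v a b * triangleWeight a b x + v a x * triangleWeight a b x
                                                  + v b x * triangleWeight a b x)
        ≡⟨ trans (∑³-distrib-+ Fn _ _) (cong (_+ edge-bx) (∑³-distrib-+ Fn _ _)) ⟩
      violatedWeight + edge-ax + edge-bx
        ≡⟨ cong₂ (λ s t → violatedWeight + s + t) edge-ax≡ab edge-bx≡ab ⟩
      violatedWeight + violatedWeight + violatedWeight
        ≡⟨ solve 1 (λ t → t :+ t :+ t := con (+ 3 / 1) :* t) refl violatedWeight ⟩
      (+ 3 / 1) * violatedWeight ∎
      where
      open ≤-Reasoning
      Fn = allFin n
      v : Fin n → Fin n → ℚ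
      v a b = 𝟙 (violated a b)
      edge-ax edge-bx : ℚ
      edge-ax = ∑³ Fn (λ a b x → v a x * triangleWeight a b x)
      edge-bx = ∑³ Fn (λ a b x → v b x * triangleWeight a b x)
      edge-ax≡ab : edge-ax ≡ violatedWeight
      edge-ax≡ab = trans (∑³-swap₂₃ Fn _) (∑³-cong Fn (λ a b x → cong (v a b *_) (triangleWeight-swap₂₃ a x b)))
      edge-bx≡ab : edge-bx ≡ violatedWeight
      edge-bx≡ab = trans (∑³-swap₁₂ Fn _)
        (trans (∑³-cong Fn (λ a b x → cong (v a x *_) (triangleWeight-swap₁₂ b a x))) edge-ax≡ab)

    violatedCharge : Fin n → Fin n → ℚ
    violatedCharge a b = 𝟙 (violated a b) * pairCharge a b

    violatedCharge-double : pairSum violatedCharge + pairSum violatedCharge ≡ violatedWeight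
    violatedCharge-double = trans
      (pairSum-double violatedCharge
        (λ a b → cong₂ _*_ (cong 𝟙 (violated-sym a b)) (pairCharge-sym a b))
        (λ a → trans (cong (𝟙 (violated a a) *_) (pairCharge-diag a)) (*-zeroʳ (𝟙 (violated a a)))))
      (∑-cong (allFin n) (λ a → ∑-cong (allFin n) (λ b →
        sym (∑-*ˡ (allFin n) (𝟙 (violated a b)) (triangleWeight a b)))))

    pairCharge≤3violatedCharge : pairSum pairCharge ≤ (+ 3 / 1) * pairSum violatedCharge
    pairCharge≤3violatedCharge = p+p≤q+q⇒p≤q (begin
      pairSum pairCharge + pairSum pairCharge       ≡⟨ pairSum-double pairCharge pairCharge-sym pairCharge-diag ⟩
      ∑³ (allFin n) triangleWeight                  ≤⟨ triangles≤3violated ⟩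
      (+ 3 / 1) * violatedWeight                    ≡⟨ cong ((+ 3 / 1) *_) violatedCharge-double ⟨
      (+ 3 / 1) * (pairSum violatedCharge + pairSum violatedCharge)
        ≡⟨ *-distribˡ-+ (+ 3 / 1) (pairSum violatedCharge) (pairSum violatedCharge) ⟩
      (+ 3 / 1) * pairSum violatedCharge + (+ 3 / 1) * pairSum violatedCharge ∎)
      where open ≤-Reasoning

    violatedCharge≤cost : pairSum violatedCharge ≤ cost G ω (sameLabel L)
    violatedCharge≤cost = subst (pairSum violatedCharge ≤_) (sym (cost≡pairSum G ω (sameLabel L)))
      (pairSum-mono (λ a b _ → begin
        𝟙 (violated a b) * pairCharge a b
          ≡⟨ cong (𝟙 (violated a b) *_) (pairCharge≡ a b) ⟩
        𝟙 (violated a b) * (ω a * ω b * charge n (allFin n) a b)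
          ≡⟨ solve 4 (λ v p q c → v :* (p :* q :* c) := p :* q :* v :* c)
                     refl (𝟙 (violated a b)) (ω a) (ω b) (charge n (allFin n) a b) ⟩
        ω a * ω b * 𝟙 (violated a b) * charge n (allFin n) a b
          ≤⟨ *-monoˡ-≤-0≤ (0≤* (0≤* (<⇒≤ (ω-pos a)) (<⇒≤ (ω-pos b))) (0≤𝟙 (violated a b)))
               (≤-trans (charge≤𝟙 n (allFin n) a b (Nodup-allFin n))
                        (𝟙≤1 (memb a (allFin n) ∧ memb b (allFin n)))) ⟩
        ω a * ω b * 𝟙 (violated a b) * 1ℚ
          ≡⟨ *-identityʳ _ ⟩
        ω a * ω b * 𝟙 (violated a b) ∎))
      where open ≤-Reasoning

lemma29 : (n : ℕ) (G : Graph n) (ω : Weights n) →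
          (∀ u v → G u v ≡ G v u) → (∀ u → G u u ≡ false) →
          (∀ u → 0ℚ < ω u) →
          (L : Fin n → Fin n) →
          expectedPivotCost G ω ≤ ((+ 3 / 1) * cost G ω (sameLabel L))
lemma29 n G ω G-sym _ ω-pos L = begin
  expectedPivotCost G ω                       ≤⟨ expectedPivotCost≤pairCharge ⟩
  pairSum pairCharge                          ≤⟨ pairCharge≤3violatedCharge L ⟩
  (+ 3 / 1) * pairSum (violatedCharge L)      ≤⟨ *-monoˡ-≤-0≤ {+ 3 / 1} (≤ᵇ⇒≤ _) (violatedCharge≤cost L) ⟩
  (+ 3 / 1) * cost G ω (sameLabel L)          ∎
  where
  open ≤-Reasoning
  open Approximation G ω ω-pos G-sym
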